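{- Let $a \ge 4$ and $n \ge 2$ be integers. Suppose there exist positive integers $x_0, t_0$ with $a x_0 > n$ and a nonnegative integer $q$ such that $$t_0^2 (a x_0 - n)^2 - 2 n t_0 x_0 = q^2.$$ Then $y = t_0(a x_0 - n) - q$ and $z = t_0(a x_0 - n) + q$ are positive integers and $$\frac{a}{n} = \frac{1}{x_0} + \frac{1}{y} + \frac{1}{z}.$$ -}

module Defs where

open import Data.Nat as ℕ using (ℕ; suc)
open import Data.Integer as ℤ using (ℤ; +_)
open import Data.Integer.Properties using (<-≤-trans)
open import Data.Rational using (ℚ; _/_)

-- The rational number m/d for an integer m and a positive integer d
-- (the proof of 0 < d supplies the nonzero-denominator instance).
frac : ℤ → (d : ℤ) → + 0 ℤ.< d → ℚ
frac m (+ suc k) _ = m / suc k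
frac m (+ 0) (ℤ.+<+ ())

inv⁺ : (d : ℤ) → + 0 ℤ.< d → ℚ
inv⁺ = frac (+ 1)

2≤⇒pos : {n : ℤ} → + 2 ℤ.≤ n → + 0 ℤ.< n
2≤⇒pos h = <-≤-trans (ℤ.+<+ (ℕ.s≤s ℕ.z≤n)) h

-- Put P = t₀(a x₀ − n) and K = 2 n t₀ x₀. The hypothesis says P² − q² = K, so y = P − q and z = P + q
-- have product K and sum 2P: they are the roots of u² − 2P u + K. Hence
-- 1/y + 1/z = 2P / K = (a x₀ − n) / (n x₀) = a/n − 1/x₀. Positivity of y follows from y z = K > 0 and z > 0.
module Submission where

import Data.Nat as ℕ
open import Data.Integer as ℤ using (ℤ; +_; +[1+_]; +<+; _+_; _-_; _*_; _<_; _≤_; nonNegative)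
open import Data.Integer.Properties
  using (+-monoˡ-<; +-inverseʳ; +-mono-<-≤; *-monoʳ-<-pos; *-cancelʳ-<-nonNeg; <⇒≤)
open import Data.Integer.Tactic.RingSolver using (solve-∀; solve)
open import Data.List using (_∷_; [])
open import Data.Rational as ℚ using (fromℚᵘ)
open import Data.Rational.Properties using (toℚᵘ-injective; toℚᵘ-fromℚᵘ; toℚᵘ-homo-+; fromℚᵘ-cong)
open import Data.Rational.Unnormalised as ℚᵘ using (ℚᵘ; mkℚᵘ; *≡*)
open import Data.Rational.Unnormalised.Properties using (≃-trans; ≃-sym; +-cong)
open import Data.Product using (Σ; _,_)
open import Relation.Binary.PropositionalEquality using (_≡_; sym; trans; cong; cong₂; subst; module ≡-Reasoning)

open import Defs

i<j⇒0<j-i : ∀ {i j} → i < j → + 0 < j - i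
i<j⇒0<j-i {i} {j} i<j = subst (_< j - i) (+-inverseʳ i) (+-monoˡ-< (ℤ.- i) i<j)

0<i⇒0<j⇒0<i*j : ∀ {i j} → + 0 < i → + 0 < j → + 0 < i * j
0<i⇒0<j⇒0<i*j {i} {j} 0<i 0<j = *-monoʳ-<-pos j {{ℤ.positive 0<j}} 0<i

fromℚᵘ-homo-+ : ∀ p q → fromℚᵘ (p ℚᵘ.+ q) ≡ fromℚᵘ p ℚ.+ fromℚᵘ q
fromℚᵘ-homo-+ p q = toℚᵘ-injective
  (≃-trans (toℚᵘ-fromℚᵘ (p ℚᵘ.+ q))
  (≃-trans (+-cong (≃-sym (toℚᵘ-fromℚᵘ p)) (≃-sym (toℚᵘ-fromℚᵘ q)))
           (≃-sym (toℚᵘ-homo-+ (fromℚᵘ p) (fromℚᵘ q)))))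

frac≡inv⁺+inv⁺+inv⁺ : ∀ {a n x y z} (0<n : + 0 < n) (0<x : + 0 < x) (0<y : + 0 < y) (0<z : + 0 < z)
  → a * (x * y * z) ≡ (y * z + x * z + x * y) * n
  → frac a n 0<n ≡ inv⁺ x 0<x ℚ.+ inv⁺ y 0<y ℚ.+ inv⁺ z 0<z
frac≡inv⁺+inv⁺+inv⁺ {a} {+[1+ n ]} {+[1+ x ]} {+[1+ y ]} {+[1+ z ]} _ _ _ _ cross = begin
  fromℚᵘ (mkℚᵘ a n)
    ≡⟨ fromℚᵘ-cong {mkℚᵘ a n} {(1/ x ℚᵘ.+ 1/ y) ℚᵘ.+ 1/ z} a/n≃1/x+1/y+1/z ⟩
  fromℚᵘ ((1/ x ℚᵘ.+ 1/ y) ℚᵘ.+ 1/ z)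
    ≡⟨ fromℚᵘ-homo-+ (1/ x ℚᵘ.+ 1/ y) (1/ z) ⟩
  fromℚᵘ (1/ x ℚᵘ.+ 1/ y) ℚ.+ fromℚᵘ (1/ z)
    ≡⟨ cong (ℚ._+ fromℚᵘ (1/ z)) (fromℚᵘ-homo-+ (1/ x) (1/ y)) ⟩
  fromℚᵘ (1/ x) ℚ.+ fromℚᵘ (1/ y) ℚ.+ fromℚᵘ (1/ z) ∎
  where
  open ≡-Reasoning
  1/_ : ℕ.ℕ → ℚᵘ
  1/ d = mkℚᵘ (+ 1) d
  numerator-of-sum : ∀ x y z → y * z + x * z + x * y ≡ (+ 1 * y + + 1 * x) * z + + 1 * (x * y)
  numerator-of-sum = solve-∀
  a/n≃1/x+1/y+1/z : mkℚᵘ a n ℚᵘ.≃ (1/ x ℚᵘ.+ 1/ y) ℚᵘ.+ 1/ z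
  a/n≃1/x+1/y+1/z = *≡* (trans cross (cong (_* +[1+ n ]) (numerator-of-sum +[1+ x ] +[1+ y ] +[1+ z ])))
frac≡inv⁺+inv⁺+inv⁺ {n = + 0} (+<+ ()) _ _ _ _
frac≡inv⁺+inv⁺+inv⁺ {x = + 0} _ (+<+ ()) _ _ _
frac≡inv⁺+inv⁺+inv⁺ {y = + 0} _ _ (+<+ ()) _ _
frac≡inv⁺+inv⁺+inv⁺ {z = + 0} _ _ _ (+<+ ()) _

square-difference-factorises : ∀ t D q K → t * t * (D * D) - K ≡ q * q → (t * D - q) * (t * D + q) ≡ K
square-difference-factorises t D q K eq = begin
  (t * D - q) * (t * D + q)           ≡⟨ solve (t ∷ D ∷ q ∷ []) ⟩
  t * t * (D * D) - q * q             ≡⟨ cong (t * t * (D * D) -_) (sym eq) ⟩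
  t * t * (D * D) - (t * t * (D * D) - K) ≡⟨ solve (t ∷ D ∷ K ∷ []) ⟩
  K                                   ∎
  where open ≡-Reasoning

conjugates-sum : ∀ P q → (P - q) + (P + q) ≡ + 2 * P
conjugates-sum = solve-∀

sum-product⇒egyptian-identity : ∀ {a n x y z t} → y * z ≡ + 2 * n * t * x → y + z ≡ + 2 * (t * (a * x - n))
  → a * (x * y * z) ≡ (y * z + x * z + x * y) * n
sum-product⇒egyptian-identity {a} {n} {x} {y} {z} {t} yz≡2ntx y+z≡2t[ax-n] = begin
  a * (x * y * z)                            ≡⟨ solve (a ∷ x ∷ y ∷ z ∷ []) ⟩
  a * x * (y * z)                            ≡⟨ cong (a * x *_) yz≡2ntx ⟩
  a * x * (+ 2 * n * t * x)                  ≡⟨ solve (a ∷ n ∷ x ∷ t ∷ []) ⟩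
  (+ 2 * n * t * x + x * (+ 2 * (t * (a * x - n)))) * n
    ≡⟨ cong₂ (λ u v → (u + x * v) * n) (sym yz≡2ntx) (sym y+z≡2t[ax-n]) ⟩
  (y * z + x * (y + z)) * n                  ≡⟨ solve (n ∷ x ∷ y ∷ z ∷ []) ⟩
  (y * z + x * z + x * y) * n                ∎
  where open ≡-Reasoning

mainTheorem5 : (a n x₀ t₀ q : ℤ)
    → + 4 ≤ a → (hn : + 2 ≤ n)
    → (hx : + 0 < x₀) → + 0 < t₀ → n < a * x₀ → + 0 ≤ q
    → t₀ * t₀ * ((a * x₀ - n) * (a * x₀ - n)) - + 2 * n * t₀ * x₀ ≡ q * q
    → Σ (+ 0 < t₀ * (a * x₀ - n) - q) λ hy
    → Σ (+ 0 < t₀ * (a * x₀ - n) + q) λ hz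
    → frac a n (2≤⇒pos hn) ≡ inv⁺ x₀ hx ℚ.+ inv⁺ (t₀ * (a * x₀ - n) - q) hy ℚ.+ inv⁺ (t₀ * (a * x₀ - n) + q) hz
mainTheorem5 a n x₀ t₀ q _ hn hx ht n<ax₀ hq eq =
  hy , hz , frac≡inv⁺+inv⁺+inv⁺ (2≤⇒pos hn) hx hy hz
                (sum-product⇒egyptian-identity {a} {n} {x₀} {t = t₀} yz≡K (conjugates-sum P q))
  where
  D = a * x₀ - n
  P = t₀ * D
  K = + 2 * n * t₀ * x₀
  yz≡K : (P - q) * (P + q) ≡ K
  yz≡K = square-difference-factorises t₀ D q K eq
  hz : + 0 < P + q
  hz = +-mono-<-≤ (0<i⇒0<j⇒0<i*j ht (i<j⇒0<j-i n<ax₀)) hq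
  0<K : + 0 < K
  0<K = 0<i⇒0<j⇒0<i*j (0<i⇒0<j⇒0<i*j (0<i⇒0<j⇒0<i*j {+ 2} (+<+ ℕ.z<s) (2≤⇒pos hn)) ht) hx
  hy : + 0 < P - q
  hy = *-cancelʳ-<-nonNeg {i = + 0} {j = P - q} (P + q) {{nonNegative (<⇒≤ hz)}} (subst (+ 0 <_) (sym yz≡K) 0<K)
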